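{- For all lengths $a,b$: $a<b$ or $a=b$ or $b<a$.
   Context: Synthetic plane geometry with classical logic. Primitive notions: points, lines (with equality), incidence $A\in x$, a ternary betweenness relation $\mathrm{Bet}(A,B,C)$ ("$B$ strictly between $A$ and $C$"), a type of lengths with a map $(A,B)\mapsto|AB|$ such that every length equals $|AB|$ for some $A,B$. Points are collinear if some line contains all of them. Axioms: (incidence) there is a point; for every point there is a distinct point; every line has a point; for every line $x$ and $A\in x$ there is $B\in x$, $B\neq A$; for every line there is a point not on it; through two distinct points there is a line; if $A\neq B$, $A,B\in x$ and $x\neq y$ then $A\notin y$ or $B\notin y$. (betweenness) if $\mathrm{Bet}(A,B,C)$ then $A\neq C$, $A,B,C$ collinear, $\mathrm{Bet}(C,B,A)$, and not $\mathrm{Bet}(B,A,C)$. (lengths) $|AB|=|CC|$ iff $A=B$; $|AB|=|BA|$. (line–circle) for $O,A,B$ with $A\neq O$ there is $C$ with ($\mathrm{Bet}(A,O,C)$ or $O=C$) and $|OB|=|OC|$. "$P,Q$ on opposite sides of line $x$": $P,Q\notin x$ and some $O\in x$ has $\mathrm{Bet}(P,O,Q)$; "same side": $P,Q\notin x$ and no such $O$. (Pasch) if $P,Q$ are on opposite sides of $x$ and $R\notin x$, then $P,R$ or $R,Q$ are on opposite sides of $x$. Write $\mathrm{SR}(O,P,Q)$ for: $O\neq P$, $O\neq Q$, $O,P,Q$ collinear, not $\mathrm{Bet}(P,O,Q)$. (concentric circles) for points $O,A,A',B,B'$: if $\mathrm{Bet}(O,A,B)$, $\mathrm{SR}(O,A',B')$,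 $|OA|=|OA'|$ and $|OB|=|OB'|$, then $\mathrm{Bet}(O,A',B')$ and $|AB|=|A'B'|$. (circle–circle) for points $O,A,B,O',A',B',P$: if $O,O',P$ are not collinear, $\mathrm{Bet}$ holds for each of the triples $(A,A',B),(A,A',B'),(A,B,B'),(A',B,B')$, $\mathrm{Bet}(A,O,B)$ with $|OA|=|OB|$, and $\mathrm{Bet}(A',O',B')$ with $|O'A'|=|O'B'|$, then there is a point $Q$ with $P,Q$ on the same side of the line through $O,O'$, $|OQ|=|OA|$ and $|O'Q|=|O'A'|$. Order: $a<b$ iff there are points $A,B,C$ with $|AB|=a$, $|AC|=b$ and ($\mathrm{Bet}(A,B,C)$ or ($A=B$ and $B\neq C$)). -}

module Defs where

open import Data.Product using (Σ; ∃; _×_; _,_)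
open import Data.Sum using (_⊎_)
open import Relation.Nullary using (¬_)
open import Relation.Binary.PropositionalEquality using (_≡_; _≢_)

record Signature : Set₁ where
  field
    Point  : Set
    Line   : Set
    _∈_    : Point → Line → Set
    Bet    : Point → Point → Point → Set
    Length : Set
    len    : Point → Point → Length

module Notions (S : Signature) where
  open Signature S

  Collinear3 : Point → Point → Point → Set
  Collinear3 A B C = Σ Line λ x → (A ∈ x) × (B ∈ x) × (C ∈ x)

  OppSide : Line → Point → Point → Set
  OppSide x P Q = ¬ (P ∈ x) × ¬ (Q ∈ x) × Σ Point λ O → (O ∈ x) × Bet P O Q

  SameSide : Line → Point → Point → Set
  SameSide x P Q = ¬ (P ∈ x) × ¬ (Q ∈ x) × ¬ (Σ Point λ O → (O ∈ x) × Bet P O Q)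

  SR : Point → Point → Point → Set
  SR O P Q = (O ≢ P) × (O ≢ Q) × Collinear3 O P Q × ¬ Bet P O Q

  _<ℓ_ : Length → Length → Set
  a <ℓ b = Σ Point λ A → Σ Point λ B → Σ Point λ C →
             (len A B ≡ a) × (len A C ≡ b) × (Bet A B C ⊎ ((A ≡ B) × (B ≢ C)))

record Geometry : Set₁ where
  field
    sig : Signature
  open Signature sig public
  open Notions sig public
  field
    lem : (P : Set) → P ⊎ ¬ P
    point-exists    : Point
    other-point     : ∀ (A : Point) → Σ Point λ B → B ≢ A
    line-has-point  : ∀ (x : Line) → Σ Point λ A → A ∈ x
    line-second-pt  : ∀ (x : Line) (A : Point) → A ∈ x → Σ Point λ B → (B ∈ x) × (B ≢ A)
    point-off-line  : ∀ (x : Line) → Σ Point λ A → ¬ (A ∈ x)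
    line-through    : ∀ (A B : Point) → A ≢ B → Σ Line λ x → (A ∈ x) × (B ∈ x)
    line-unique     : ∀ (A B : Point) (x y : Line) → A ≢ B → A ∈ x → B ∈ x → x ≢ y →
                      ¬ (A ∈ y) ⊎ ¬ (B ∈ y)
    bet-distinct    : ∀ {A B C} → Bet A B C → A ≢ C
    bet-collinear   : ∀ {A B C} → Bet A B C → Collinear3 A B C
    bet-sym         : ∀ {A B C} → Bet A B C → Bet C B A
    bet-not-left    : ∀ {A B C} → Bet A B C → ¬ Bet B A C
    len-surj        : ∀ (a : Length) → Σ Point λ A → Σ Point λ B → len A B ≡ a
    len-zero→       : ∀ {A B C} → len A B ≡ len C C → A ≡ B
    len-zero←       : ∀ {A B C} → A ≡ B → len A B ≡ len C C
    len-sym         : ∀ A B → len A B ≡ len B A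
    line-circle     : ∀ (O A B : Point) → A ≢ O →
                      Σ Point λ C → (Bet A O C ⊎ O ≡ C) × (len O B ≡ len O C)
    pasch           : ∀ (x : Line) (P Q R : Point) → OppSide x P Q → ¬ (R ∈ x) →
                      OppSide x P R ⊎ OppSide x R Q
    concentric      : ∀ (O A A' B B' : Point) → Bet O A B → SR O A' B' →
                      len O A ≡ len O A' → len O B ≡ len O B' →
                      Bet O A' B' × (len A B ≡ len A' B')
    -- circle–circle (the line through O, O' is any line containing both;
    -- it is unique since O ≠ O')
    circle-circle   : ∀ (O A B O' A' B' P : Point) → ¬ Collinear3 O O' P →
                      Bet A A' B → Bet A A' B' → Bet A B B' → Bet A' B B' →
                      Bet A O B → len O A ≡ len O B →
                      Bet A' O' B' → len O' A' ≡ len O' B' →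
                      ∀ (x : Line) → O ∈ x → O' ∈ x →
                      Σ Point λ Q → SameSide x P Q × (len O Q ≡ len O A) × (len O' Q ≡ len O' A')

-- Realise a as |AB| and b as |CD|. Euclid's compass construction (I.1 from the
-- circle-circle axiom, I.2 from concentric circles) moves |CD| to A, and laying it
-- off on the ray AB gives E with |AE| = b. On a ray from A either B = E or one of
-- B, E lies between A and the other, which is exactly the trichotomy of <ℓ; the
-- ray statement is the plane-separation argument of Hilbert, driven by Pasch.
module Submission where

open import Defs
open import Data.Product using (Σ; _×_; _,_; proj₁; proj₂)
open import Data.Sum using (_⊎_; inj₁; inj₂; [_,_]′)
open import Function using (id; _∘_)
open import Relation.Nullary.Negation using (¬_; contradiction; contradiction₂)
open import Relation.Binary.PropositionalEquality
  using (_≡_; _≢_; refl; sym; trans; subst; ≢-sym; module ≡-Reasoning)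

module Properties (G : Geometry) where
  open Geometry G

  bet-≢ˡ : ∀ {A B C} → Bet A B C → A ≢ B
  bet-≢ˡ ABC refl = bet-not-left ABC ABC

  bet-≢ʳ : ∀ {A B C} → Bet A B C → B ≢ C
  bet-≢ʳ ABC refl = bet-≢ˡ (bet-sym ABC) refl

  ∈-∉-≢ : ∀ {P Q x} → P ∈ x → ¬ (Q ∈ x) → P ≢ Q
  ∈-∉-≢ Px Q∉x refl = Q∉x Px

  lines-equal : ∀ {A B x y} → A ≢ B → A ∈ x → B ∈ x → A ∈ y → B ∈ y → x ≡ y
  lines-equal {A} {B} {x} {y} A≢B Ax Bx Ay By with lem (x ≡ y)
  ... | inj₁ x≡y = x≡y
  ... | inj₂ x≢y =
    contradiction₂ (line-unique A B x y A≢B Ax Bx x≢y) (λ A∉y → A∉y Ay) (λ B∉y → B∉y By)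

  transversal-∉ : ∀ {A B D x y} → A ∈ x → B ∈ x → B ≢ A → A ∈ y → D ∈ y → ¬ (D ∈ x) → ¬ (B ∈ y)
  transversal-∉ {D = D} Ax Bx B≢A Ay Dy D∉x By = D∉x (subst (D ∈_) (lines-equal B≢A By Ay Bx Ax) Dy)

  bet-middle-∈ : ∀ {A B C x} → Bet A B C → A ∈ x → C ∈ x → B ∈ x
  bet-middle-∈ ABC Ax Cx with bet-collinear ABC
  ... | y , Ay , By , Cy = subst (_ ∈_) (lines-equal (bet-distinct ABC) Ay Cy Ax Cx) By

  bet-end-∈ : ∀ {A B C x} → Bet A B C → A ∈ x → B ∈ x → C ∈ x
  bet-end-∈ ABC Ax Bx with bet-collinear ABC
  ... | y , Ay , By , Cy = subst (_ ∈_) (lines-equal (bet-≢ˡ ABC) Ay By Ax Bx) Cy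

  lines-meet-once : ∀ {P O R x y} → ¬ (P ∈ x) → P ∈ y → O ∈ x → O ∈ y → R ∈ x → R ∈ y → O ≡ R
  lines-meet-once {P} {O} {R} P∉x Py Ox Oy Rx Ry with lem (O ≡ R)
  ... | inj₁ O≡R = O≡R
  ... | inj₂ O≢R = contradiction (subst (P ∈_) (lines-equal O≢R Oy Ry Ox Rx) Py) P∉x

  opposite-crossing : ∀ {P Q R x y} → OppSide x P Q → P ∈ y → Q ∈ y → R ∈ x → R ∈ y → Bet P R Q
  opposite-crossing (P∉x , _ , O , Ox , POQ) Py Qy Rx Ry =
    subst (λ O → Bet _ O _) (lines-meet-once P∉x Py Ox (bet-middle-∈ POQ Py Qy) Rx Ry) POQ

  extend-by : ∀ {O A B} → A ≢ O → O ≢ B → Σ Point λ C → Bet A O C × len O B ≡ len O C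
  extend-by {O} {A} {B} A≢O O≢B with line-circle O A B A≢O
  ... | C , inj₁ AOC , OB≡OC = C , AOC , OB≡OC
  ... | C , inj₂ refl , OB≡OO = contradiction (len-zero→ OB≡OO) O≢B

  extend : ∀ {O A} → A ≢ O → Σ Point λ C → Bet A O C
  extend A≢O with extend-by A≢O (≢-sym A≢O)
  ... | C , AOC , _ = C , AOC

  bet-split : ∀ {U X V W l} → Bet U X V → U ∈ l → V ∈ l → W ∈ l → W ≢ X → Bet U X W ⊎ Bet W X V
  bet-split {U} {X} {V} {W} {l} UXV Ul Vl Wl W≢X with bet-middle-∈ UXV Ul Vl | point-off-line l
  ... | Xl | D , D∉l with line-through X D (∈-∉-≢ Xl D∉l)
  ... | z , Xz , Dz =
    [ (λ UW → inj₁ (opposite-crossing UW Ul Wl Xz Xl))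
    , (λ WV → inj₂ (opposite-crossing WV Wl Vl Xz Xl)) ]′
      (pasch z U V W (off Ul (bet-≢ˡ UXV) , off Vl (≢-sym (bet-≢ʳ UXV)) , X , Xz , UXV) (off Wl W≢X))
    where
    off : ∀ {Y} → Y ∈ l → Y ≢ X → ¬ (Y ∈ z)
    off Yl Y≢X = transversal-∉ Xl Yl Y≢X Xz Dz D∉l

  opposite-of-¬bet : ∀ {B X Y D G l y} → B ∈ l → X ∈ l → Y ∈ l → B ≢ X → Y ≢ X → ¬ (D ∈ l) →
                     Bet B D G → X ∈ y → D ∈ y → ¬ Bet B X Y → OppSide y Y G
  opposite-of-¬bet {B = B} {Y = Y} {D = D} {G = G} {y = y} Bl Xl Yl B≢X Y≢X D∉l BDG Xy Dy ¬BXY =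
    [ (λ BY → contradiction (opposite-crossing BY Bl Yl Xy Xl) ¬BXY) , id ]′
      (pasch y B G Y (B∉y , G∉y , D , Dy , BDG) (transversal-∉ Xl Yl Y≢X Xy Dy D∉l))
    where
    B∉y : ¬ (B ∈ y)
    B∉y = transversal-∉ Xl Bl B≢X Xy Dy D∉l
    G∉y : ¬ (G ∈ y)
    G∉y Gy = B∉y (bet-end-∈ (bet-sym BDG) Gy Dy)

  -- Hilbert's argument: with D off l and Bet B D G, Pasch gives E on AD with Bet C E G
  -- and shows that CD separates A from G, hence Bet A D E; Pasch for the line BD
  -- in the triangle AEC then gives Bet A B C.
  bet-of-¬bet : ∀ {A B C l} → A ∈ l → B ∈ l → C ∈ l → A ≢ B → B ≢ C → A ≢ C →
                ¬ Bet B A C → ¬ Bet A C B → Bet A B C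
  bet-of-¬bet {A} {B} {C} {l} Al Bl Cl A≢B B≢C A≢C ¬BAC ¬ACB with point-off-line l
  ... | D , D∉l with extend (∈-∉-≢ Bl D∉l)
  ... | G , BDG with bet-collinear BDG | line-through A D (∈-∉-≢ Al D∉l) | line-through C D (∈-∉-≢ Cl D∉l)
  ... | m , Bm , Dm , Gm | n , An , Dn | k , Ck , Dk
    with opposite-of-¬bet Bl Al Cl (≢-sym A≢B) (≢-sym A≢C) D∉l BDG An Dn ¬BAC
  ... | _ , _ , E , En , CEG with bet-collinear CEG
  ... | p , Cp , Ep , Gp =
    [ (λ AC → opposite-crossing AC Al Cl Bm Bl)
    , (λ CE → contradiction (bet-sym (opposite-crossing CE Cp Ep Gm Gp)) (bet-not-left (bet-sym CEG))) ]′
      (pasch m A E C (A∉m , E∉m , D , Dm , ADE) C∉m)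
    where
    AG-opposite-k : OppSide k A G
    AG-opposite-k = opposite-of-¬bet Bl Cl Al B≢C A≢C D∉l BDG Ck Dk (¬ACB ∘ bet-sym)
    G∉k : ¬ (G ∈ k)
    G∉k = proj₁ (proj₂ AG-opposite-k)
    A∉m : ¬ (A ∈ m)
    A∉m = transversal-∉ Bl Al A≢B Bm Dm D∉l
    C∉m : ¬ (C ∈ m)
    C∉m = transversal-∉ Bl Cl (≢-sym B≢C) Bm Dm D∉l
    E∉k : ¬ (E ∈ k)
    E∉k Ek = G∉k (subst (G ∈_) (lines-equal (bet-≢ˡ CEG) Cp Ep Ck Ek) Gp)
    E∉m : ¬ (E ∈ m)
    E∉m Em = C∉m (subst (C ∈_) (lines-equal (bet-≢ʳ CEG) Ep Gp Em Gm) Cp)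
    ADE : Bet A D E
    ADE = [ (λ AE → opposite-crossing AE An En Dk Dn)
          , (λ EG → contradiction (opposite-crossing EG Ep Gp Ck Cp) (bet-not-left CEG)) ]′
            (pasch k A G E AG-opposite-k E∉k)

  bet-trichotomy : ∀ {A B C l} → A ∈ l → B ∈ l → C ∈ l → A ≢ B → B ≢ C → A ≢ C →
                   Bet A B C ⊎ (Bet B A C ⊎ Bet A C B)
  bet-trichotomy {A} {B} {C} Al Bl Cl A≢B B≢C A≢C with lem (Bet B A C) | lem (Bet A C B)
  ... | inj₁ BAC | _        = inj₂ (inj₁ BAC)
  ... | inj₂ _   | inj₁ ACB = inj₂ (inj₂ ACB)
  ... | inj₂ ¬BAC | inj₂ ¬ACB = inj₁ (bet-of-¬bet Al Bl Cl A≢B B≢C A≢C ¬BAC ¬ACB)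

  ¬bet-beyond : ∀ {W O A E} → Bet W O A → Bet W O E → ¬ Bet A O E
  ¬bet-beyond {W = W} {A = A} {E = E} WOA WOE AOE with bet-collinear WOA
  ... | l , Wl , Ol , Al =
    contradiction₂ (bet-trichotomy Wl Al El (bet-distinct WOA) (bet-distinct AOE) (bet-distinct WOE))
      ¬WAE (λ AWE⊎WEA → contradiction₂ AWE⊎WEA ¬AWE ¬WEA)
    where
    El : E ∈ l
    El = bet-end-∈ WOE Wl Ol
    ¬WAE : ¬ Bet W A E
    ¬WAE WAE = contradiction₂ (bet-split WAE Wl El Ol (bet-≢ʳ WOA))
                 (bet-not-left (bet-sym WOA) ∘ bet-sym) (bet-not-left AOE)
    ¬AWE : ¬ Bet A W E
    ¬AWE AWE = contradiction₂ (bet-split AWE Al El Ol (≢-sym (bet-≢ˡ WOA)))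
                 (bet-not-left WOA ∘ bet-sym) (bet-not-left WOE)
    ¬WEA : ¬ Bet W E A
    ¬WEA WEA = contradiction₂ (bet-split WEA Wl Al Ol (bet-≢ʳ WOE))
                 (bet-not-left (bet-sym WOE) ∘ bet-sym) (bet-not-left (bet-sym AOE))

  SR-of-opposite : ∀ {O B W C} → Bet B O W → Bet W O C → SR O B C
  SR-of-opposite BOW WOC with bet-collinear BOW
  ... | l , Bl , Ol , Wl =
    ≢-sym (bet-≢ˡ BOW) , bet-≢ʳ WOC , (l , Ol , Bl , bet-end-∈ WOC Wl Ol) , ¬bet-beyond (bet-sym BOW) WOC

  lay-off : ∀ {O B Y} → O ≢ B → O ≢ Y → Σ Point λ C → SR O B C × len O Y ≡ len O C
  lay-off O≢B O≢Y with extend (≢-sym O≢B)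
  ... | W , BOW with extend-by (≢-sym (bet-≢ʳ BOW)) O≢Y
  ... | C , WOC , OY≡OC = C , SR-of-opposite BOW WOC , OY≡OC

  ray-trichotomy : ∀ {O B C} → SR O B C → B ≡ C ⊎ (Bet O B C ⊎ Bet O C B)
  ray-trichotomy {O} {B} {C} (O≢B , O≢C , (l , Ol , Bl , Cl) , ¬BOC) with lem (B ≡ C)
  ... | inj₁ B≡C = inj₁ B≡C
  ... | inj₂ B≢C =
    inj₂ ([ inj₁ , [ (λ BOC → contradiction BOC ¬BOC) , inj₂ ]′ ]′ (bet-trichotomy Ol Bl Cl O≢B B≢C O≢C))

  bet-outer : ∀ {A B C D} → Bet A B C → Bet B C D → Bet A B D
  bet-outer ABC BCD with bet-collinear ABC
  ... | l , Al , Bl , Cl = [ id , (λ DBC → contradiction (bet-sym DBC) (bet-not-left BCD)) ]′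
                             (bet-split ABC Al Cl (bet-end-∈ BCD Bl Cl) (≢-sym (bet-distinct BCD)))

  -- Euclid I.1: Q is the apex of an equilateral triangle on PC, cut out by the
  -- circles about P and C through C and P, whose diameters on PC are AC and PB.
  equidistant-point : ∀ {P C} → P ≢ C → Σ Point λ Q → Q ≢ P × Q ≢ C × len Q P ≡ len Q C
  equidistant-point {P} {C} P≢C with line-through P C P≢C
  ... | l , Pl , Cl with extend-by (≢-sym P≢C) P≢C | extend-by P≢C (≢-sym P≢C) | point-off-line l
  ... | A , CPA , PC≡PA | B , PCB , CP≡CB | R , R∉l
    with circle-circle P A C C P B R PCR-not-collinear (bet-sym CPA) APB ACB PCB
                       (bet-sym CPA) (sym PC≡PA) PCB CP≡CB l Pl Cl
    where
    PCR-not-collinear : ¬ Collinear3 P C R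
    PCR-not-collinear (y , Py , Cy , Ry) = R∉l (subst (R ∈_) (lines-equal P≢C Py Cy Pl Cl) Ry)
    APB : Bet A P B
    APB = bet-outer (bet-sym CPA) PCB
    ACB : Bet A C B
    ACB = bet-sym (bet-outer (bet-sym PCB) CPA)
  ... | Q , _ , PQ≡PA , CQ≡CP = Q , Q≢P , Q≢C , QP≡QC
    where
    open ≡-Reasoning
    Q≢P : Q ≢ P
    Q≢P refl = bet-≢ʳ CPA (len-zero→ (sym PQ≡PA))
    Q≢C : Q ≢ C
    Q≢C refl = P≢C (sym (len-zero→ (sym CQ≡CP)))
    QP≡QC : len Q P ≡ len Q C
    QP≡QC = begin
      len Q P ≡⟨ len-sym Q P ⟩
      len P Q ≡⟨ PQ≡PA ⟩
      len P A ≡⟨ sym PC≡PA ⟩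
      len P C ≡⟨ len-sym P C ⟩
      len C P ≡⟨ sym CQ≡CP ⟩
      len C Q ≡⟨ len-sym C Q ⟩
      len Q C ∎

  -- Euclid I.2: since |QC| = |QP|, the concentric-circles axiom turns the
  -- extension CY of QC by |CD| into a segment PX on the ray QP.
  len-from : ∀ P C D → Σ Point λ X → len P X ≡ len C D
  len-from P C D with lem (C ≡ D) | lem (P ≡ C)
  ... | inj₁ C≡D | _ = P , sym (len-zero← C≡D)
  ... | inj₂ C≢D | inj₁ refl = D , refl
  ... | inj₂ C≢D | inj₂ P≢C with equidistant-point P≢C
  ... | Q , Q≢P , Q≢C , QP≡QC with extend-by Q≢C C≢D
  ... | Y , QCY , CD≡CY with lay-off Q≢P (bet-distinct QCY)
  ... | X , QPX-ray , QY≡QX = X , trans (sym CY≡PX) (sym CD≡CY)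
    where
    CY≡PX : len C Y ≡ len P X
    CY≡PX = proj₂ (concentric Q C P Y X QCY QPX-ray (sym QP≡QC) QY≡QX)

  <ℓ-of-bet : ∀ {A B C} → Bet A B C → len A B <ℓ len A C
  <ℓ-of-bet {A} {B} {C} ABC = A , B , C , refl , refl , inj₁ ABC

  <ℓ-of-≢ : ∀ {A C} → A ≢ C → len A A <ℓ len A C
  <ℓ-of-≢ {A} {C} A≢C = A , A , C , refl , refl , inj₂ (refl , A≢C)

  compare-at : ∀ A B X → len A B <ℓ len A X ⊎ (len A B ≡ len A X ⊎ len A X <ℓ len A B)
  compare-at A B X with lem (A ≡ B) | lem (A ≡ X)
  ... | inj₁ refl | inj₁ refl = inj₂ (inj₁ refl)
  ... | inj₁ refl | inj₂ A≢X = inj₁ (<ℓ-of-≢ A≢X)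
  ... | inj₂ A≢B | inj₁ refl = inj₂ (inj₂ (<ℓ-of-≢ A≢B))
  ... | inj₂ A≢B | inj₂ A≢X with lay-off A≢B A≢X
  ... | E , ABE-ray , AX≡AE rewrite AX≡AE with ray-trichotomy ABE-ray
  ... | inj₁ refl = inj₂ (inj₁ refl)
  ... | inj₂ (inj₁ ABE) = inj₁ (<ℓ-of-bet ABE)
  ... | inj₂ (inj₂ AEB) = inj₂ (inj₂ (<ℓ-of-bet AEB))

theorem15 : (G : Geometry) → let open Geometry G in
    ∀ (a b : Length) → (a <ℓ b) ⊎ ((a ≡ b) ⊎ (b <ℓ a))
theorem15 G a b with Geometry.len-surj G a | Geometry.len-surj G b
... | A , B , refl | C , D , refl with Properties.len-from G A C D
... | X , AX≡CD rewrite sym AX≡CD = Properties.compare-at G A B X
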